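{- Let $\Gamma$ be a graph satisfying (P) and (N), let $\mathbb{H}$ be a $\{2,3\}$-hypergraph on $\mathfrak{C}(\Gamma)$ satisfying (E), and fix isomorphisms $\varphi_C:P_{v(C)}\to C$ for $C\in\mathfrak{C}(\Gamma)$. Let $C\in\mathfrak{C}_{\rm even}(\Gamma)$. Then: 1. $V(\Gamma\bullet\mathbb{H})\setminus\{\varphi_C(0),\varphi_C(1)\}$ is a module of $(\Gamma\bullet\mathbb{H})-\varphi_C(0)$; 2. $V(\Gamma\bullet\mathbb{H})\setminus\{\varphi_C(2w(C)-2),\varphi_C(2w(C)-1)\}$ is a module of $(\Gamma\bullet\mathbb{H})-\varphi_C(2w(C)-1)$; 3. if $w(C)\geq2$, then for each $m\in\{1,\ldots,2w(C)-2\}$, $\{\varphi_C(m-1),\varphi_C(m+1)\}$ is a module of $(\Gamma\bullet\mathbb{H})-\varphi_C(m)$.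
   Context: All structures are finite. A hypergraph $H$ has vertex set $V(H)$ and edge set $E(H)\subseteq 2^{V(H)}\setminus\{\emptyset\}$; $v(H)=|V(H)|$; 3-hypergraph: all edges have 3 elements; $\{2,3\}$-hypergraph: all edges have 2 or 3 elements. $H-X$ is the induced subhypergraph on $V(H)\setminus X$, $H-v=H-\{v\}$. $M\subseteq V(H)$ is a module if for each $e\in E(H)$ with $e\cap M\neq\emptyset$, $e\setminus M\neq\emptyset$ there is $m\in M$ with $e\cap M=\{m\}$ and $(e\setminus\{m\})\cup\{n\}\in E(H)$ for all $n\in M$. For a tournament $T$, $C_3(T)$ is the 3-hypergraph on $V(T)$ whose edges are the 3-sets inducing a 3-cycle. $L_m$: tournament on $\{0,\dots,m-1\}$ with arcs $ij$ for $i<j$; $U_{2n+1}$: obtained from $L_{2n+1}$ by reversing all arcs between two even vertices. Construction. $P_n$ is the path on $\{0,\ldots,n-1\}$ with edges $\{k,k+1\}$. For a graph $\Gamma$: $\mathfrak{C}(\Gamma)$ its components; $\mathfrak{C}_{\rm even}(\Gamma)$, $\mathfrak{C}_{\rm odd}(\Gamma)$ those with even/odd number of vertices; $\mathfrak{C}_1(\Gamma)$ the one-vertex components; $w(C)=\lfloor v(C)/2\rfloor$. (P): every component is a path. (N): $\mathfrak{C}(\Gamma)\setminus\mathfrak{C}_1(\Gamma)\neq\emptyset$; for each odd $C$, if $V(\Gamma)\setminus V(C)\neq\emptyset$ then $(\mathfrak{C}(\Gamma)\setminus\mathfrak{C}_1(\Gamma))\setminus\{C\}\neq\emptyset$; for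 each even $C$, if $|V(\Gamma)\setminus V(C)|\ge2$ then $(\mathfrak{C}(\Gamma)\setminus\mathfrak{C}_1(\Gamma))\setminus\{C\}\neq\emptyset$. (E): each 2-element edge of $\mathbb{H}$ contains one even and one odd component; each 3-element edge consists of odd components. $\Gamma\bullet\mathbb{H}$ is the 3-hypergraph on $V(\Gamma)$ whose edge set is the union of: (i) for each $C\in\mathfrak{C}_{\rm odd}(\Gamma)\setminus\mathfrak{C}_1(\Gamma)$, $\varphi_C(E(C_3(U_{v(C)})))$; (ii) for each edge $\{C,D\}$ of $\mathbb{H}$, $C$ even, $D$ odd, the sets $\{\varphi_C(2i),\varphi_C(2j+1),\varphi_D(2k)\}$, $0\le i\le j\le w(C)-1$, $0\le k\le w(D)$; (iii) for each edge $\{I,J,K\}$ of $\mathbb{H}$, the sets $\{\varphi_I(2i),\varphi_J(2j),\varphi_K(2k)\}$, $0\le i\le w(I)$, $0\le j\le w(J)$, $0\le k\le w(K)$. -}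

module Defs where

open import Data.Nat using (ℕ; zero; suc; _+_; _*_; _∸_; _≤_; _<_; _/_)
open import Data.Fin using (Fin; toℕ; fromℕ<)
open import Data.Fin.Subset using (Subset; ⁅_⁆; _∈_; _∉_; _⊆_; _∩_; _∪_; _─_; _-_; ∣_∣; Nonempty; ⊤)
open import Data.Product using (Σ; ∃; ∃-syntax; _×_; _,_)
open import Data.Sum using (_⊎_)
open import Relation.Binary.PropositionalEquality using (_≡_; _≢_; subst)
open import Relation.Nullary using (¬_)

Even : ℕ → Set
Even m = ∃[ t ] m ≡ 2 * t

Odd : ℕ → Set
Odd m = ∃[ t ] m ≡ suc (2 * t)

half : ℕ → ℕ
half m = m / 2

record Hypergraph (n : ℕ) : Set₁ where
  field
    V : Subset n
    E : Subset n → Set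

open Hypergraph public

_minus_ : ∀ {n} → Hypergraph n → Subset n → Hypergraph n
V (H minus X) = V H ─ X
E (H minus X) e = E H e × e ⊆ (V H ─ X)

_minusV_ : ∀ {n} → Hypergraph n → Fin n → Hypergraph n
H minusV v = H minus ⁅ v ⁆

IsModule : ∀ {n} → Hypergraph n → Subset n → Set
IsModule {n} H M =
  M ⊆ V H ×
  (∀ e → E H e → Nonempty (e ∩ M) → Nonempty (e ─ M) →
     ∃[ m ] (m ∈ M × (e ∩ M) ≡ ⁅ m ⁆ ×
             (∀ x → x ∈ M → E H ((e - m) ∪ ⁅ x ⁆))))

-- arc i → j of L_m: i < j
-- U_m: reverse all arcs between two even vertices
UArc : ℕ → ℕ → Set
UArc i j = (i < j × ¬ (Even i × Even j)) ⊎ (j < i × Even i × Even j)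

C3U : (m : ℕ) → Subset m → Set
C3U m e = ∃[ x ] ∃[ y ] ∃[ z ]
  (e ≡ (⁅ x ⁆ ∪ ⁅ y ⁆) ∪ ⁅ z ⁆ ×
   UArc (toℕ x) (toℕ y) × UArc (toℕ y) (toℕ z) × UArc (toℕ z) (toℕ x))

-- A graph Γ on Fin n satisfying (P), given together with its components
-- (indexed by Fin k, C has v(C) = s C vertices) and isomorphisms
-- φ C : P_{s C} → C.

record PathGraph (n : ℕ) : Set₁ where
  field
    Adj  : Fin n → Fin n → Set
    adj-irrefl : ∀ u → ¬ Adj u u
    adj-sym    : ∀ u v → Adj u v → Adj v u
    k : ℕ
    s : Fin k → ℕ
    s-pos : ∀ c → 1 ≤ s c
    φ : (c : Fin k) → Fin (s c) → Fin n
    φ-surj : ∀ v → ∃[ c ] ∃[ a ] φ c a ≡ v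
    φ-inj  : ∀ c d (a : Fin (s c)) (b : Fin (s d)) → φ c a ≡ φ d b →
             Σ (c ≡ d) λ eq → subst (λ x → Fin (s x)) eq a ≡ b
    -- adjacency is exactly the disjoint union of the paths P_{s c}
    φ-adj  : ∀ c d (a : Fin (s c)) (b : Fin (s d)) →
             Adj (φ c a) (φ d b) →
             Σ (c ≡ d) λ eq → suc (toℕ (subst (λ x → Fin (s x)) eq a)) ≡ toℕ b
                               ⊎ suc (toℕ b) ≡ toℕ (subst (λ x → Fin (s x)) eq a)
    adj-φ  : ∀ c (a b : Fin (s c)) →
             (suc (toℕ a) ≡ toℕ b ⊎ suc (toℕ b) ≡ toℕ a) → Adj (φ c a) (φ c b)

open PathGraph public

module _ {n : ℕ} (Γ : PathGraph n) where

  InComp : Fin (k Γ) → Fin n → Set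
  InComp c v = ∃[ a ] φ Γ c a ≡ v

  φℕ : (c : Fin (k Γ)) (x : ℕ) → x < s Γ c → Fin n
  φℕ c x p = φ Γ c (fromℕ< p)

  w : Fin (k Γ) → ℕ
  w c = half (s Γ c)

  NonTrivial : Fin (k Γ) → Set
  NonTrivial c = 2 ≤ s Γ c

  CondN : Set
  CondN =
    (∃[ c ] NonTrivial c) ×
    (∀ c → Odd (s Γ c) → (∃[ v ] ¬ InComp c v) →
       ∃[ d ] (d ≢ c × NonTrivial d)) ×
    (∀ c → Even (s Γ c) →
       (∃[ u ] ∃[ v ] (u ≢ v × ¬ InComp c u × ¬ InComp c v)) →
       ∃[ d ] (d ≢ c × NonTrivial d))

  Is23Hypergraph : (Subset (k Γ) → Set) → Set
  Is23Hypergraph EH = ∀ e → EH e → ∣ e ∣ ≡ 2 ⊎ ∣ e ∣ ≡ 3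

  CondE : (Subset (k Γ) → Set) → Set
  CondE EH =
    (∀ e → EH e → ∣ e ∣ ≡ 2 →
       ∃[ c ] ∃[ d ] (e ≡ ⁅ c ⁆ ∪ ⁅ d ⁆ × Even (s Γ c) × Odd (s Γ d))) ×
    (∀ e → EH e → ∣ e ∣ ≡ 3 → ∀ c → c ∈ e → Odd (s Γ c))

  data BulletEdge (EH : Subset (k Γ) → Set) : Subset n → Set where
    edge-i : ∀ c → Odd (s Γ c) → NonTrivial c →
             (f : Subset (s Γ c)) → C3U (s Γ c) f →
             ∀ e → (∀ v → v ∈ e → ∃[ a ] (a ∈ f × φ Γ c a ≡ v)) →
                   (∀ a → a ∈ f → φ Γ c a ∈ e) →
             BulletEdge EH e
    edge-ii : ∀ c d → EH (⁅ c ⁆ ∪ ⁅ d ⁆) → c ≢ d → Even (s Γ c) → Odd (s Γ d) →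
              ∀ i j l → i ≤ j → j ≤ w c ∸ 1 → l ≤ w d →
              (p : 2 * i < s Γ c) (q : suc (2 * j) < s Γ c) (r : 2 * l < s Γ d) →
              BulletEdge EH ((⁅ φℕ c (2 * i) p ⁆ ∪ ⁅ φℕ c (suc (2 * j)) q ⁆)
                               ∪ ⁅ φℕ d (2 * l) r ⁆)
    edge-iii : ∀ I J K → EH ((⁅ I ⁆ ∪ ⁅ J ⁆) ∪ ⁅ K ⁆) →
               ∣ (⁅ I ⁆ ∪ ⁅ J ⁆) ∪ ⁅ K ⁆ ∣ ≡ 3 →
               ∀ i j l → i ≤ w I → j ≤ w J → l ≤ w K →
               (p : 2 * i < s Γ I) (q : 2 * j < s Γ J) (r : 2 * l < s Γ K) →
               BulletEdge EH ((⁅ φℕ I (2 * i) p ⁆ ∪ ⁅ φℕ J (2 * j) q ⁆)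
                                ∪ ⁅ φℕ K (2 * l) r ⁆)

  bullet : (Subset (k Γ) → Set) → Hypergraph n
  V (bullet EH) = ⊤
  E (bullet EH) = BulletEdge EH

-- Only the type-(ii) edges of Γ • ℍ in which C is the even component meet C, and they are
-- the triples {φ_C(2i), φ_C(2j+1), v} with i ≤ j ≤ w(C) − 1 and v outside C. In such an
-- edge the even vertex may be moved to any φ_C(2i′) with i′ ≤ j, and the odd vertex to any
-- φ_C(2j′+1) with i ≤ j′ ≤ w(C) − 1. Hence every edge through φ_C(1) contains φ_C(0), and
-- every edge through φ_C(2w−2) contains φ_C(2w−1): after deleting φ_C(0) (resp. φ_C(2w−1))
-- no edge leaves the proposed module at all. For an inner vertex φ_C(m), deleting it
-- forbids the one position between the two neighbours, so an edge meets
-- {φ_C(m−1), φ_C(m+1)} in a single vertex, which can be moved to the other neighbour.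

module Submission where

open import Defs
open import Data.Nat using (ℕ; zero; suc; _*_; _∸_; _≤_; _<_; _/_)
open import Data.Nat.Properties
  using (suc-injective; 1+n≢n; even≢odd; *-suc; *-comm; *-cancelˡ-≡; *-cancelˡ-<; <⇒≤; <⇒≤pred;
         ≤∧≢⇒<; ≤-antisym; ≤-pred; m≤n⇒m≤1+n; n≤0⇒n≡0)
open import Data.Nat.DivMod using (m*n/n≡m)
open import Data.Fin using (Fin; toℕ; fromℕ<; _≟_)
open import Data.Fin.Properties using (toℕ-fromℕ<)
open import Data.Fin.Subset using (Subset; ⁅_⁆; _∈_; _∉_; _⊆_; _∩_; _∪_; _─_; _-_; ∣_∣; Nonempty; ⊤)
open import Data.Fin.Subset.Properties
  using (x∈⁅x⁆; x∈⁅y⁆⇒x≡y; x∈p∪q⁺; x∈p∪q⁻; x∈p∩q⁺; x∈p∩q⁻; ∈⊤; _∈?_; p─q⊆p; x∈p∧x∉q⇒x∈p─q;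
         x∈p∧x≢y⇒x∈p-y; ⊆-antisym; ∪-comm; ∪-idem)
open import Data.Vec using (_∷_; there)
open import Data.Product using (∃-syntax; _×_; _,_; proj₁; proj₂)
open import Data.Sum using (_⊎_; inj₁; inj₂; map; map₂)
open import Data.Empty using (⊥-elim)
open import Function using (_∘_)
open import Relation.Binary.PropositionalEquality
open import Relation.Nullary using (¬_; yes; no; contradiction)

private
  variable
    n : ℕ
    a b c x y z : Fin n
    e p q : Subset n

x∈p─q⇒x∉q : ∀ (p q : Subset n) → x ∈ p ─ q → x ∉ q
x∈p─q⇒x∉q (_ ∷ p) (_ ∷ q) (there x∈p─q) (there x∈q) = x∈p─q⇒x∉q p q x∈p─q x∈q

x∈p∧x∉p─q⇒x∈q : x ∈ p → x ∉ p ─ q → x ∈ q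
x∈p∧x∉p─q⇒x∈q {x = x} {q = q} x∈p x∉p─q with x ∈? q
... | yes x∈q = x∈q
... | no x∉q = contradiction (x∈p∧x∉q⇒x∈p─q x∈p x∉q) x∉p─q

∈-pair⁻ : x ∈ ⁅ a ⁆ ∪ ⁅ b ⁆ → x ≡ a ⊎ x ≡ b
∈-pair⁻ {a = a} {b = b} = map (x∈⁅y⁆⇒x≡y a) (x∈⁅y⁆⇒x≡y b) ∘ x∈p∪q⁻ ⁅ a ⁆ ⁅ b ⁆

∈-pair⁺ : x ≡ a ⊎ x ≡ b → x ∈ ⁅ a ⁆ ∪ ⁅ b ⁆
∈-pair⁺ (inj₁ refl) = x∈p∪q⁺ (inj₁ (x∈⁅x⁆ _))
∈-pair⁺ (inj₂ refl) = x∈p∪q⁺ (inj₂ (x∈⁅x⁆ _))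

triple : Fin n → Fin n → Fin n → Subset n
triple a b c = (⁅ a ⁆ ∪ ⁅ b ⁆) ∪ ⁅ c ⁆

∈-triple⁻ : x ∈ triple a b c → x ≡ a ⊎ x ≡ b ⊎ x ≡ c
∈-triple⁻ {a = a} {b = b} {c = c} x∈ with x∈p∪q⁻ (⁅ a ⁆ ∪ ⁅ b ⁆) ⁅ c ⁆ x∈
... | inj₁ x∈ab = map₂ inj₁ (∈-pair⁻ x∈ab)
... | inj₂ x∈c = inj₂ (inj₂ (x∈⁅y⁆⇒x≡y c x∈c))

∈-triple⁺ : x ≡ a ⊎ x ≡ b ⊎ x ≡ c → x ∈ triple a b c
∈-triple⁺ (inj₁ x≡a) = x∈p∪q⁺ (inj₁ (∈-pair⁺ (inj₁ x≡a)))
∈-triple⁺ (inj₂ (inj₁ x≡b)) = x∈p∪q⁺ (inj₁ (∈-pair⁺ (inj₂ x≡b)))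
∈-triple⁺ (inj₂ (inj₂ refl)) = x∈p∪q⁺ (inj₂ (x∈⁅x⁆ _))

triple-swap : ∀ (a b c : Fin n) → triple a b c ≡ triple b a c
triple-swap a b c = cong (_∪ ⁅ c ⁆) (∪-comm ⁅ a ⁆ ⁅ b ⁆)

∈-exchange⁻ : y ∈ (e - x) ∪ ⁅ z ⁆ → (y ∈ e × y ≢ x) ⊎ y ≡ z
∈-exchange⁻ {e = e} {x = x} {z = z} y∈ with x∈p∪q⁻ (e - x) ⁅ z ⁆ y∈
... | inj₁ y∈e-x = inj₁ (p─q⊆p e ⁅ x ⁆ y∈e-x ,
                    λ { refl → x∈p─q⇒x∉q e ⁅ x ⁆ y∈e-x (x∈⁅x⁆ x) })
... | inj₂ y∈z = inj₂ (x∈⁅y⁆⇒x≡y z y∈z)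

∈-exchange⁺ : (y ∈ e × y ≢ x) ⊎ y ≡ z → y ∈ (e - x) ∪ ⁅ z ⁆
∈-exchange⁺ (inj₁ (y∈e , y≢x)) = x∈p∪q⁺ (inj₁ (x∈p∧x≢y⇒x∈p-y y∈e y≢x))
∈-exchange⁺ (inj₂ refl) = x∈p∪q⁺ (inj₂ (x∈⁅x⁆ _))

exchange-⊆ : e ⊆ p → z ∈ p → (e - x) ∪ ⁅ z ⁆ ⊆ p
exchange-⊆ e⊆p z∈p y∈ with ∈-exchange⁻ y∈
... | inj₁ (y∈e , _) = e⊆p y∈e
... | inj₂ refl = z∈p

exchange-self : x ∈ e → (e - x) ∪ ⁅ x ⁆ ≡ e
exchange-self {x = x} {e = e} x∈e = ⊆-antisym into onto
  where
  into : (e - x) ∪ ⁅ x ⁆ ⊆ e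
  into y∈ with ∈-exchange⁻ y∈
  ... | inj₁ (y∈e , _) = y∈e
  ... | inj₂ refl = x∈e
  onto : e ⊆ (e - x) ∪ ⁅ x ⁆
  onto {y} y∈e with y ≟ x
  ... | yes y≡x = ∈-exchange⁺ (inj₂ y≡x)
  ... | no y≢x = ∈-exchange⁺ (inj₁ (y∈e , y≢x))

exchange-first : a ≢ b → a ≢ c → (triple a b c - a) ∪ ⁅ z ⁆ ≡ triple z b c
exchange-first {a = a} {b = b} {c = c} {z = z} a≢b a≢c = ⊆-antisym into onto
  where
  into : (triple a b c - a) ∪ ⁅ z ⁆ ⊆ triple z b c
  into y∈ with ∈-exchange⁻ y∈
  ... | inj₂ y≡z = ∈-triple⁺ (inj₁ y≡z)
  ... | inj₁ (y∈abc , y≢a) with ∈-triple⁻ y∈abc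
  ...   | inj₁ y≡a = contradiction y≡a y≢a
  ...   | inj₂ y∈bc = ∈-triple⁺ (inj₂ y∈bc)
  onto : triple z b c ⊆ (triple a b c - a) ∪ ⁅ z ⁆
  onto y∈ with ∈-triple⁻ y∈
  ... | inj₁ y≡z = ∈-exchange⁺ (inj₂ y≡z)
  ... | inj₂ (inj₁ refl) = ∈-exchange⁺ (inj₁ (∈-triple⁺ (inj₂ (inj₁ refl)) , a≢b ∘ sym))
  ... | inj₂ (inj₂ refl) = ∈-exchange⁺ (inj₁ (∈-triple⁺ (inj₂ (inj₂ refl)) , a≢c ∘ sym))

exchange-second : b ≢ a → b ≢ c → (triple a b c - b) ∪ ⁅ z ⁆ ≡ triple a z c
exchange-second {b = b} {a = a} {c = c} {z = z} b≢a b≢c = begin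
  (triple a b c - b) ∪ ⁅ z ⁆  ≡⟨ cong (λ t → (t - b) ∪ ⁅ z ⁆) (triple-swap a b c) ⟩
  (triple b a c - b) ∪ ⁅ z ⁆  ≡⟨ exchange-first b≢a b≢c ⟩
  triple z a c                ≡⟨ triple-swap z a c ⟩
  triple a z c                ∎
  where open ≡-Reasoning

∩-pair : a ∈ e → b ∉ e → e ∩ (⁅ a ⁆ ∪ ⁅ b ⁆) ≡ ⁅ a ⁆
∩-pair {a = a} {e = e} {b = b} a∈e b∉e = ⊆-antisym into onto
  where
  into : e ∩ (⁅ a ⁆ ∪ ⁅ b ⁆) ⊆ ⁅ a ⁆
  into y∈ with x∈p∩q⁻ e _ y∈
  ... | y∈e , y∈ab with ∈-pair⁻ y∈ab
  ...   | inj₁ refl = x∈⁅x⁆ a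
  ...   | inj₂ refl = contradiction y∈e b∉e
  onto : ⁅ a ⁆ ⊆ e ∩ (⁅ a ⁆ ∪ ⁅ b ⁆)
  onto y∈a with x∈⁅y⁆⇒x≡y a y∈a
  ... | refl = x∈p∩q⁺ (a∈e , ∈-pair⁺ (inj₁ refl))

p⊆q─⁅x⁆⇒x∉p : e ⊆ p ─ ⁅ x ⁆ → x ∉ e
p⊆q─⁅x⁆⇒x∉p {x = x} e⊆ x∈e = x∈p─q⇒x∉q _ ⁅ x ⁆ (e⊆ x∈e) (x∈⁅x⁆ x)

ModuleCondition : Hypergraph n → Subset n → Subset n → Set
ModuleCondition H M e =
  ∃[ m ] (m ∈ M × e ∩ M ≡ ⁅ m ⁆ × (∀ x → x ∈ M → E H ((e - m) ∪ ⁅ x ⁆)))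

complement-isModule : ∀ (H : Hypergraph n) (a b : Fin n) → (∀ e → E H e → b ∈ e → a ∈ e) →
                      IsModule (H minusV a) (V H ─ (⁅ a ⁆ ∪ ⁅ b ⁆))
complement-isModule H a b b∈⇒a∈ = M⊆V , condition
  where
  M = V H ─ (⁅ a ⁆ ∪ ⁅ b ⁆)
  M⊆V : M ⊆ V H ─ ⁅ a ⁆
  M⊆V y∈M = x∈p∧x∉q⇒x∈p─q (p─q⊆p _ _ y∈M) (x∈p─q⇒x∉q _ _ y∈M ∘ ∈-pair⁺ ∘ inj₁ ∘ x∈⁅y⁆⇒x≡y a)
  condition : ∀ e → E (H minusV a) e → Nonempty (e ∩ M) → Nonempty (e ─ M) →
              ModuleCondition (H minusV a) M e
  condition e (he , e⊆) _ (y , y∈e─M) with p─q⊆p e M y∈e─M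
  ... | y∈e with ∈-pair⁻ (x∈p∧x∉p─q⇒x∈q (p─q⊆p _ _ (e⊆ y∈e)) (x∈p─q⇒x∉q e M y∈e─M))
  ...   | inj₁ refl = ⊥-elim (p⊆q─⁅x⁆⇒x∉p e⊆ y∈e)
  ...   | inj₂ refl = ⊥-elim (p⊆q─⁅x⁆⇒x∉p e⊆ (b∈⇒a∈ e he y∈e))

pair-moduleCondition : ∀ (H : Hypergraph n) → E H e → a ∈ e → b ∉ e → E H ((e - a) ∪ ⁅ b ⁆) →
                       ModuleCondition H (⁅ a ⁆ ∪ ⁅ b ⁆) e
pair-moduleCondition {e = e} {a = a} {b = b} H he a∈e b∉e he′ =
  a , ∈-pair⁺ (inj₁ refl) , ∩-pair a∈e b∉e , replace
  where
  replace : ∀ x → x ∈ ⁅ a ⁆ ∪ ⁅ b ⁆ → E H ((e - a) ∪ ⁅ x ⁆)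
  replace x x∈ with ∈-pair⁻ x∈
  ... | inj₁ refl = subst (E H) (sym (exchange-self a∈e)) he
  ... | inj₂ refl = he′

Replaceable : Hypergraph n → Fin n → Fin n → Set
Replaceable H a b = ∀ e → E H e → a ∈ e → b ∉ e × E H ((e - a) ∪ ⁅ b ⁆)

pair-isModule : ∀ (H : Hypergraph n) → a ∈ V H → b ∈ V H → Replaceable H a b → Replaceable H b a →
                IsModule H (⁅ a ⁆ ∪ ⁅ b ⁆)
pair-isModule {a = a} {b = b} H a∈V b∈V via-a via-b = pair⊆V , condition
  where
  pair⊆V : ⁅ a ⁆ ∪ ⁅ b ⁆ ⊆ V H
  pair⊆V y∈ with ∈-pair⁻ y∈
  ... | inj₁ refl = a∈V
  ... | inj₂ refl = b∈V
  condition : ∀ e → E H e → Nonempty (e ∩ (⁅ a ⁆ ∪ ⁅ b ⁆)) → Nonempty (e ─ (⁅ a ⁆ ∪ ⁅ b ⁆)) →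
              ModuleCondition H (⁅ a ⁆ ∪ ⁅ b ⁆) e
  condition e he (y , y∈) _ with x∈p∩q⁻ e _ y∈
  ... | y∈e , y∈ab with ∈-pair⁻ y∈ab
  ...   | inj₁ refl = let b∉e , he′ = via-a e he y∈e in pair-moduleCondition H he y∈e b∉e he′
  ...   | inj₂ refl = let a∉e , he′ = via-b e he y∈e in
                      subst (λ M → ModuleCondition H M e) (∪-comm ⁅ b ⁆ ⁅ a ⁆)
                            (pair-moduleCondition H he y∈e a∉e he′)

even-or-odd : ∀ m → Even m ⊎ Odd m
even-or-odd zero = inj₁ (0 , refl)
even-or-odd (suc m) with even-or-odd m
... | inj₁ (t , refl) = inj₂ (t , refl)
... | inj₂ (t , refl) = inj₁ (suc t , sym (*-suc 2 t))

module _ (Γ : PathGraph n) where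

  φ-component : ∀ {c d} {a : Fin (s Γ c)} {b : Fin (s Γ d)} → φ Γ c a ≡ φ Γ d b → c ≡ d
  φ-component = proj₁ ∘ φ-inj Γ _ _ _ _

  φℕ-injective : ∀ {c d i j} .{p : i < s Γ c} .{q : j < s Γ d} →
                 φ Γ c (fromℕ< p) ≡ φ Γ d (fromℕ< q) → c ≡ d × i ≡ j
  φℕ-injective {c} {d} {p = p} {q = q} eq with φ-inj Γ c d (fromℕ< p) (fromℕ< q) eq
  ... | refl , p≡q = refl , trans (sym (toℕ-fromℕ< p)) (trans (cong toℕ p≡q) (toℕ-fromℕ< q))

module EvenComponent (Γ : PathGraph n) (EH : Subset (k Γ) → Set)
  (odd-triples : ∀ e → EH e → ∣ e ∣ ≡ 3 → ∀ c → c ∈ e → Odd (s Γ c))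
  (C : Fin (k Γ)) (ω : ℕ) (s≡2ω : s Γ C ≡ 2 * ω) where

  -- Irrelevant in its bound, like fromℕ<, so it agrees definitionally with φℕ Γ C.
  φC : (i : ℕ) → .(i < s Γ C) → Fin n
  φC i p = φ Γ C (fromℕ< p)

  H : Fin n → Hypergraph n
  H v = bullet Γ EH minusV v

  ¬odd-C : ¬ Odd (s Γ C)
  ¬odd-C (t , s≡1+2t) = even≢odd ω t (trans (sym s≡2ω) s≡1+2t)

  w≡ω : w Γ C ≡ ω
  w≡ω = trans (cong half s≡2ω) (trans (cong (_/ 2) (*-comm 2 ω)) (m*n/n≡m ω 2))

  odd-index-bound : ∀ {j} → suc (2 * j) < s Γ C → j ≤ w Γ C ∸ 1
  odd-index-bound {j} lt = subst (λ m → j ≤ m ∸ 1) (sym w≡ω)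
    (<⇒≤pred (*-cancelˡ-< 2 j ω (<⇒≤ (subst (suc (2 * j) <_) s≡2ω lt))))

  φC∈⊤-φC : ∀ {i j} .{p : i < s Γ C} .{q : j < s Γ C} → i ≢ j → φC i p ∈ ⊤ ─ ⁅ φC j q ⁆
  φC∈⊤-φC i≢j = x∈p∧x≢y⇒x∈p-y ∈⊤ (i≢j ∘ proj₂ ∘ φℕ-injective Γ)

  -- The odd side {D, φ_D(2l)} of a type-(ii) edge whose even component is C; crossTriple
  -- is then the paper's edge {φ_C(2i), φ_C(2j+1), φ_D(2l)}.
  record Partner : Set where
    constructor partner
    field
      comp   : Fin (k Γ)
      linked : EH (⁅ C ⁆ ∪ ⁅ comp ⁆)
      C≢comp : C ≢ comp
      odd    : Odd (s Γ comp)
      pos    : ℕ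
      pos≤w  : pos ≤ w Γ comp
      pos<s  : 2 * pos < s Γ comp

    vertex : Fin n
    vertex = φℕ Γ comp (2 * pos) pos<s

  open Partner

  crossTriple : Partner → ∀ i j → 2 * i < s Γ C → suc (2 * j) < s Γ C → Subset n
  crossTriple δ i j pa pb = triple (φC (2 * i) pa) (φC (suc (2 * j)) pb) (vertex δ)

  cross-edge : ∀ δ {i j} (pa : 2 * i < s Γ C) (pb : suc (2 * j) < s Γ C) →
               i ≤ j → j ≤ w Γ C ∸ 1 → BulletEdge Γ EH (crossTriple δ i j pa pb)
  cross-edge (partner d linked C≢d odd-d l l≤w pd) pa pb i≤j j≤w =
    edge-ii C d linked C≢d (ω , s≡2ω) odd-d _ _ l i≤j j≤w l≤w pa pb pd

  data CrossEdge : Subset n → Set where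
    cross : ∀ δ {i j} (pa : 2 * i < s Γ C) (pb : suc (2 * j) < s Γ C) →
            i ≤ j → j ≤ w Γ C ∸ 1 → CrossEdge (crossTriple δ i j pa pb)

  C∈components : ∀ {c₁ c₂ c₃ x} .{p : x < s Γ C}
                   {a₁ : Fin (s Γ c₁)} {a₂ : Fin (s Γ c₂)} {a₃ : Fin (s Γ c₃)} →
                 φC x p ∈ triple (φ Γ c₁ a₁) (φ Γ c₂ a₂) (φ Γ c₃ a₃) → C ∈ triple c₁ c₂ c₃
  C∈components = ∈-triple⁺ ∘ map (φ-component Γ) (map (φ-component Γ) (φ-component Γ)) ∘ ∈-triple⁻

  edge-through-C : ∀ {e x} .{p : x < s Γ C} → BulletEdge Γ EH e → φC x p ∈ e → CrossEdge e
  edge-through-C (edge-i c odd-c _ _ _ _ e⊆φ[f] _) v∈e =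
    let _ , _ , φa≡v = e⊆φ[f] _ v∈e in
    ⊥-elim (¬odd-C (subst (Odd ∘ s Γ) (φ-component Γ φa≡v) odd-c))
  edge-through-C (edge-ii c d linked c≢d _ odd-d i j l i≤j j≤w l≤w pa pb pd) v∈e
    with ∈-pair⁻ (subst (C ∈_) (cong (_∪ ⁅ d ⁆) (∪-idem ⁅ c ⁆)) (C∈components v∈e))
  ... | inj₁ refl = cross (partner d linked c≢d odd-d l l≤w pd) pa pb i≤j j≤w
  ... | inj₂ refl = ⊥-elim (¬odd-C odd-d)
  edge-through-C (edge-iii I J K linked card _ _ _ _ _ _ _ _ _) v∈e =
    ⊥-elim (¬odd-C (odd-triples _ linked card C (C∈components v∈e)))

  evenIndex oddIndex : ∀ {e} → CrossEdge e → ℕ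
  evenIndex (cross _ {i} _ _ _ _) = i
  oddIndex (cross _ {j = j} _ _ _ _) = j

  evenVertex oddVertex : ∀ {e} → CrossEdge e → Fin n
  evenVertex (cross _ pa _ _ _) = φC _ pa
  oddVertex (cross _ _ pb _ _) = φC _ pb

  ∈-cross⁻ : ∀ {e x} .{p : x < s Γ C} (ce : CrossEdge e) → φC x p ∈ e →
             x ≡ 2 * evenIndex ce ⊎ x ≡ suc (2 * oddIndex ce)
  ∈-cross⁻ (cross δ _ _ _ _) v∈e with ∈-triple⁻ v∈e
  ... | inj₁ eq = inj₁ (proj₂ (φℕ-injective Γ eq))
  ... | inj₂ (inj₁ eq) = inj₂ (proj₂ (φℕ-injective Γ eq))
  ... | inj₂ (inj₂ eq) = ⊥-elim (C≢comp δ (proj₁ (φℕ-injective Γ eq)))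

  even∈cross⁻ : ∀ {e y} .{p : 2 * y < s Γ C} (ce : CrossEdge e) →
                φC (2 * y) p ∈ e → y ≡ evenIndex ce
  even∈cross⁻ {y = y} ce v∈e with ∈-cross⁻ ce v∈e
  ... | inj₁ 2y≡2i = *-cancelˡ-≡ y (evenIndex ce) 2 2y≡2i
  ... | inj₂ 2y≡1+2j = contradiction 2y≡1+2j (even≢odd y (oddIndex ce))

  odd∈cross⁻ : ∀ {e y} .{p : suc (2 * y) < s Γ C} (ce : CrossEdge e) →
               φC (suc (2 * y)) p ∈ e → y ≡ oddIndex ce
  odd∈cross⁻ {y = y} ce v∈e with ∈-cross⁻ ce v∈e
  ... | inj₁ 1+2y≡2i = contradiction (sym 1+2y≡2i) (even≢odd (evenIndex ce) y)
  ... | inj₂ 1+2y≡1+2j = *-cancelˡ-≡ y (oddIndex ce) 2 (suc-injective 1+2y≡1+2j)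

  even∈cross⁺ : ∀ {e y} .{p : 2 * y < s Γ C} (ce : CrossEdge e) →
                y ≡ evenIndex ce → φC (2 * y) p ∈ e
  even∈cross⁺ (cross _ _ _ _ _) refl = ∈-triple⁺ (inj₁ refl)

  odd∈cross⁺ : ∀ {e y} .{p : suc (2 * y) < s Γ C} (ce : CrossEdge e) →
               y ≡ oddIndex ce → φC (suc (2 * y)) p ∈ e
  odd∈cross⁺ (cross _ _ _ _ _) refl = ∈-triple⁺ (inj₂ (inj₁ refl))

  even≢odd-vertex : ∀ i j .{pa : 2 * i < s Γ C} .{pb : suc (2 * j) < s Γ C} →
                    φC (2 * i) pa ≢ φC (suc (2 * j)) pb
  even≢odd-vertex i j = even≢odd i j ∘ proj₂ ∘ φℕ-injective Γ

  φC≢vertex : ∀ (δ : Partner) {x} .(p : x < s Γ C) → φC x p ≢ vertex δ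
  φC≢vertex δ _ = C≢comp δ ∘ proj₁ ∘ φℕ-injective Γ

  replace-even : ∀ {e i′} (ce : CrossEdge e) (pa′ : 2 * i′ < s Γ C) → i′ ≤ oddIndex ce →
                 BulletEdge Γ EH ((e - evenVertex ce) ∪ ⁅ φC (2 * i′) pa′ ⁆)
  replace-even (cross δ {i} {j} pa pb _ j≤w) pa′ i′≤j =
    subst (BulletEdge Γ EH) (sym (exchange-first (even≢odd-vertex i j) (φC≢vertex δ pa)))
          (cross-edge δ pa′ pb i′≤j j≤w)

  replace-odd : ∀ {e j′} (ce : CrossEdge e) (pb′ : suc (2 * j′) < s Γ C) → evenIndex ce ≤ j′ →
                BulletEdge Γ EH ((e - oddVertex ce) ∪ ⁅ φC (suc (2 * j′)) pb′ ⁆)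
  replace-odd (cross δ {i} {j} pa pb _ _) pb′ i≤j′ =
    subst (BulletEdge Γ EH) (sym (exchange-second (even≢odd-vertex i j ∘ sym) (φC≢vertex δ pb)))
          (cross-edge δ pa pb′ i≤j′ (odd-index-bound pb′))

  first-odd⇒first-even : ∀ {e} .{p₀ : 0 < s Γ C} .{p₁ : 1 < s Γ C} →
                         BulletEdge Γ EH e → φC 1 p₁ ∈ e → φC 0 p₀ ∈ e
  first-odd⇒first-even be v∈e with edge-through-C be v∈e
  ... | ce@(cross _ _ _ i≤j _) with odd∈cross⁻ {y = 0} ce v∈e
  ... | refl = even∈cross⁺ {y = 0} ce (sym (n≤0⇒n≡0 i≤j))

  last-even⇒last-odd : ∀ {u e} .{p : 2 * u < s Γ C} .{q : suc (2 * u) < s Γ C} → w Γ C ≡ suc u →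
                       BulletEdge Γ EH e → φC (2 * u) p ∈ e → φC (suc (2 * u)) q ∈ e
  last-even⇒last-odd {u} w≡1+u be v∈e with edge-through-C be v∈e
  ... | ce@(cross _ _ _ i≤j j≤w) with even∈cross⁻ {y = u} ce v∈e
  ... | refl = odd∈cross⁺ ce (≤-antisym i≤j (subst (λ m → oddIndex ce ≤ m ∸ 1) w≡1+u j≤w))

  first-pair-isModule : ∀ .{p₀ : 0 < s Γ C} .{p₁ : 1 < s Γ C} →
                        IsModule (H (φC 0 p₀)) (⊤ ─ (⁅ φC 0 p₀ ⁆ ∪ ⁅ φC 1 p₁ ⁆))
  first-pair-isModule = complement-isModule (bullet Γ EH) _ _ (λ _ → first-odd⇒first-even)

  last-positions : ∃[ u ] (w Γ C ≡ suc u × 2 * w Γ C ∸ 2 ≡ 2 * u × 2 * w Γ C ∸ 1 ≡ suc (2 * u))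
  last-positions = from-positive (subst (1 ≤_) s≡2ω (s-pos Γ C)) w≡ω
    where
    from-positive : ∀ {m} → 1 ≤ 2 * m → w Γ C ≡ m →
                    ∃[ u ] (w Γ C ≡ suc u × 2 * w Γ C ∸ 2 ≡ 2 * u × 2 * w Γ C ∸ 1 ≡ suc (2 * u))
    from-positive {zero} ()
    from-positive {suc u} _ w≡1+u rewrite w≡1+u =
      u , refl , cong (_∸ 2) (*-suc 2 u) , cong (_∸ 1) (*-suc 2 u)

  last-pair-isModule : ∀ {u x y} .{p : x < s Γ C} .{q : y < s Γ C} → w Γ C ≡ suc u →
                       x ≡ 2 * u → y ≡ suc (2 * u) →
                       IsModule (H (φC y q)) (⊤ ─ (⁅ φC x p ⁆ ∪ ⁅ φC y q ⁆))
  last-pair-isModule w≡1+u refl refl =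
    subst (IsModule (H _)) (cong (⊤ ─_) (∪-comm _ _))
          (complement-isModule (bullet Γ EH) _ _ (λ _ → last-even⇒last-odd w≡1+u))

  odd-centre-isModule : ∀ {t x y z} (p : x < s Γ C) (q : y < s Γ C) (r : z < s Γ C) →
                        x ≡ 2 * t → y ≡ suc (2 * t) → z ≡ 2 * suc t →
                        IsModule (H (φC y q)) (⁅ φC x p ⁆ ∪ ⁅ φC z r ⁆)
  odd-centre-isModule {t} p q r refl refl refl = pair-isModule (H v) a∈V b∈V via-even via-next
    where
    v : Fin n
    v = φC (suc (2 * t)) q
    a∈V : φC (2 * t) p ∈ ⊤ ─ ⁅ v ⁆
    a∈V = φC∈⊤-φC (even≢odd t t)
    b∈V : φC (2 * suc t) r ∈ ⊤ ─ ⁅ v ⁆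
    b∈V = φC∈⊤-φC (even≢odd (suc t) t)
    via-even : Replaceable (H v) (φC (2 * t) p) (φC (2 * suc t) r)
    via-even e (be , e⊆) a∈e with edge-through-C be a∈e
    ... | ce@(cross _ _ _ i≤j _) with even∈cross⁻ {y = t} ce a∈e
    ... | refl = 1+n≢n ∘ even∈cross⁻ {y = suc t} ce ,
                 replace-even ce r t<j , exchange-⊆ e⊆ b∈V
      where
      t<j : t < oddIndex ce
      t<j = ≤∧≢⇒< i≤j (p⊆q─⁅x⁆⇒x∉p e⊆ ∘ odd∈cross⁺ {y = t} ce)
    via-next : Replaceable (H v) (φC (2 * suc t) r) (φC (2 * t) p)
    via-next e (be , e⊆) b∈e with edge-through-C be b∈e
    ... | ce@(cross _ _ _ t<j _) with even∈cross⁻ {y = suc t} ce b∈e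
    ... | refl = 1+n≢n ∘ sym ∘ even∈cross⁻ {y = t} ce ,
                 replace-even ce p (<⇒≤ t<j) , exchange-⊆ e⊆ a∈V

  even-centre-isModule : ∀ {t x y z} (p : x < s Γ C) (q : y < s Γ C) (r : z < s Γ C) →
                         x ≡ suc (2 * t) → y ≡ 2 * suc t → z ≡ suc (2 * suc t) →
                         IsModule (H (φC y q)) (⁅ φC x p ⁆ ∪ ⁅ φC z r ⁆)
  even-centre-isModule {t} p q r refl refl refl = pair-isModule (H v) a∈V b∈V via-odd via-next
    where
    v : Fin n
    v = φC (2 * suc t) q
    a∈V : φC (suc (2 * t)) p ∈ ⊤ ─ ⁅ v ⁆
    a∈V = φC∈⊤-φC (even≢odd (suc t) t ∘ sym)
    b∈V : φC (suc (2 * suc t)) r ∈ ⊤ ─ ⁅ v ⁆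
    b∈V = φC∈⊤-φC (even≢odd (suc t) (suc t) ∘ sym)
    via-odd : Replaceable (H v) (φC (suc (2 * t)) p) (φC (suc (2 * suc t)) r)
    via-odd e (be , e⊆) a∈e with edge-through-C be a∈e
    ... | ce@(cross _ _ _ i≤t _) with odd∈cross⁻ {y = t} ce a∈e
    ... | refl = 1+n≢n ∘ odd∈cross⁻ {y = suc t} ce ,
                 replace-odd ce r (m≤n⇒m≤1+n i≤t) , exchange-⊆ e⊆ b∈V
    via-next : Replaceable (H v) (φC (suc (2 * suc t)) r) (φC (suc (2 * t)) p)
    via-next e (be , e⊆) b∈e with edge-through-C be b∈e
    ... | ce@(cross _ _ _ i≤1+t _) with odd∈cross⁻ {y = suc t} ce b∈e
    ... | refl = 1+n≢n ∘ sym ∘ odd∈cross⁻ {y = t} ce ,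
                 replace-odd ce p i≤t , exchange-⊆ e⊆ a∈V
      where
      i≤t : evenIndex ce ≤ t
      i≤t = ≤-pred (≤∧≢⇒< i≤1+t (p⊆q─⁅x⁆⇒x∉p e⊆ ∘ even∈cross⁺ {y = suc t} ce ∘ sym))

  -- The upper bound on m assumed in the theorem already follows from r.
  inner-pair-isModule : ∀ m → 1 ≤ m → (p : m ∸ 1 < s Γ C) (q : m < s Γ C) (r : suc m < s Γ C) →
                        IsModule (H (φC m q)) (⁅ φC (m ∸ 1) p ⁆ ∪ ⁅ φC (suc m) r ⁆)
  inner-pair-isModule (suc m) _ p q r with even-or-odd m
  ... | inj₁ (t , refl) = odd-centre-isModule p q r refl refl (sym (*-suc 2 t))
  ... | inj₂ (t , refl) =
    even-centre-isModule p q r refl (sym (*-suc 2 t)) (cong suc (sym (*-suc 2 t)))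

mainTheorem18 : ∀ {n : ℕ} (Γ : PathGraph n) → CondN Γ →
    (EH : Subset (k Γ) → Set) → Is23Hypergraph Γ EH → CondE Γ EH →
    (C : Fin (k Γ)) → Even (s Γ C) →
    ((p0 : 0 < s Γ C) (p1 : 1 < s Γ C) →
       IsModule (bullet Γ EH minusV φℕ Γ C 0 p0)
                (⊤ ─ (⁅ φℕ Γ C 0 p0 ⁆ ∪ ⁅ φℕ Γ C 1 p1 ⁆)))
    ×
    ((p : 2 * w Γ C ∸ 2 < s Γ C) (q : 2 * w Γ C ∸ 1 < s Γ C) →
       IsModule (bullet Γ EH minusV φℕ Γ C (2 * w Γ C ∸ 1) q)
                (⊤ ─ (⁅ φℕ Γ C (2 * w Γ C ∸ 2) p ⁆ ∪ ⁅ φℕ Γ C (2 * w Γ C ∸ 1) q ⁆)))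
    ×
    (2 ≤ w Γ C → ∀ m → 1 ≤ m → m ≤ 2 * w Γ C ∸ 2 →
       (p : m ∸ 1 < s Γ C) (q : m < s Γ C) (r : suc m < s Γ C) →
       IsModule (bullet Γ EH minusV φℕ Γ C m q)
                (⁅ φℕ Γ C (m ∸ 1) p ⁆ ∪ ⁅ φℕ Γ C (suc m) r ⁆))
mainTheorem18 Γ _ EH _ (_ , odd-triples) C (ω , s≡2ω) =
    (λ _ _ → first-pair-isModule)
  , (λ _ _ → let _ , w≡1+u , x≡2u , y≡1+2u = last-positions in
             last-pair-isModule w≡1+u x≡2u y≡1+2u)
  , (λ _ m 1≤m _ → inner-pair-isModule m 1≤m)
  where open EvenComponent Γ EH odd-triples C ω s≡2ω
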